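{- The adjusted correlation metric $f$ is a $\frac{10}{7}$-semi-metric on $V$; in particular $f_{uv}\le\frac{10}{7}(f_{uw}+f_{vw})$ for all $u,v,w\in V$.
   Context: $G=(V,E)$ is a complete graph with every edge labeled positive or negative; every vertex has a positive self-loop. $N_u^+$ ($N_u^-$) is the set of $v$ with $(u,v)$ positive (negative), and $\Delta_u=|N_u^+|$. The correlation metric is $d_{uv}=1-\frac{|N_u^+\cap N_v^+|}{|N_u^+\cup N_v^+|}$. The adjusted correlation metric $f$ is obtained as follows: (1) set $f=d$; (2) for every negative edge $(u,v)$ with $d_{uv}>0.7$ set $f_{uv}=1$; (3) for every $u$ with $|N_u^-\cap\{v: d_{uv}\le 0.7\}|\ge\frac{10}{3}\Delta_u$, set $f_{uv}=1$ for all $v\in V\setminus\{u\}$ (symmetrically). A function $g$ on pairs is a $\delta$-semi-metric if it is a semi-metric (nonnegative, symmetric, $g(u,u)=0$) except that the triangle inequality is replaced by $g(u,v)\le\delta(g(u,w)+g(v,w))$ for all $u,v,w$. -}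

module Defs where

open import Data.Nat using (ℕ; zero; suc; NonZero)
open import Data.Bool using (Bool; true; false; not; _∧_; _∨_; if_then_else_)
open import Data.Fin using (Fin; zero; suc; _≟_)
open import Data.Fin.Subset using (Subset; _∩_; _∪_; ∣_∣; _∈_; inside; outside)
open import Data.Fin.Subset.Properties using (x∈p∪q⁺)
open import Data.Vec using (Vec; _∷_; tabulate; lookup)
open import Data.Vec using (here; there)
open import Data.Vec.Properties using (lookup⇒[]=; lookup∘tabulate)
open import Data.Vec.Relation.Binary.Pointwise.Inductive using ()
open import Data.Sum using (inj₁)
open import Data.Integer using (+_)
open import Data.Rational using (ℚ; 0ℚ; 1ℚ; _/_; _-_; _+_; _*_; _≤_; _≤?_; _<?_)
open import Relation.Nullary.Decidable using (⌊_⌋)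
open import Relation.Binary.PropositionalEquality using (_≡_; refl; trans)

-- A complete graph on V = Fin n whose edges are labelled positive (true) or
-- negative (false); every vertex carries a positive self-loop.
record SignedGraph (n : ℕ) : Set where
  field
    pos      : Fin n → Fin n → Bool
    pos-sym  : ∀ u v → pos u v ≡ pos v u
    pos-refl : ∀ u → pos u u ≡ true

module _ {n : ℕ} (G : SignedGraph n) where
  open SignedGraph G

  N⁺ : Fin n → Subset n
  N⁺ u = tabulate (pos u)

  N⁻ : Fin n → Subset n
  N⁻ u = tabulate (λ v → not (pos u v))

  Δ : Fin n → ℕ
  Δ u = ∣ N⁺ u ∣

  private
    ∈⇒nonZero : ∀ {m} {x : Fin m} {p : Subset m} → x ∈ p → NonZero ∣ p ∣
    ∈⇒nonZero {p = inside ∷ p} _ = _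
    ∈⇒nonZero {p = outside ∷ p} (there x∈p) = ∈⇒nonZero x∈p

    u∈N⁺u : ∀ u → u ∈ N⁺ u
    u∈N⁺u u = lookup⇒[]= u (N⁺ u) (trans (lookup∘tabulate (pos u) u) (pos-refl u))

  unionNonZero : ∀ u v → NonZero ∣ N⁺ u ∪ N⁺ v ∣
  unionNonZero u v = ∈⇒nonZero (x∈p∪q⁺ (inj₁ (u∈N⁺u u)))

  d : Fin n → Fin n → ℚ
  d u v = 1ℚ - (_/_ (+ ∣ N⁺ u ∩ N⁺ v ∣) ∣ N⁺ u ∪ N⁺ v ∣ {{unionNonZero u v}})

  sevenTenths : ℚ
  sevenTenths = + 7 / 10

  tenThirds : ℚ
  tenThirds = + 10 / 3

  lightNeg : Fin n → ℕ
  lightNeg u = ∣ N⁻ u ∩ tabulate (λ v → ⌊ d u v ≤? sevenTenths ⌋) ∣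

  heavy : Fin n → Bool
  heavy u = ⌊ tenThirds * (+ Δ u / 1) ≤? (+ lightNeg u / 1) ⌋

  step2 : Fin n → Fin n → Bool
  step2 u v = not (pos u v) ∧ ⌊ sevenTenths <? d u v ⌋

  step3 : Fin n → Fin n → Bool
  step3 u v = not ⌊ u ≟ v ⌋ ∧ (heavy u ∨ heavy v)

  f : Fin n → Fin n → ℚ
  f u v = if step2 u v ∨ step3 u v then 1ℚ else d u v

record IsSemiMetricδ {n : ℕ} (δ : ℚ) (g : Fin n → Fin n → ℚ) : Set where
  field
    nonneg  : ∀ u v → 0ℚ ≤ g u v
    symm    : ∀ u v → g u v ≡ g v u
    self    : ∀ u → g u u ≡ 0ℚ
    relaxed : ∀ u v w → g u v ≤ δ * (g u w + g v w)

{-# OPTIONS --safe #-}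
-- The correlation metric is the Jaccard distance |A ⊖ B| / |A ∪ B| of positive neighbourhoods,
-- and the Jaccard distance obeys the triangle inequality: if c elements of C lie outside A ∪ B,
-- then d(A,B) ≤ (|A ⊖ B| + c) / (|A ∪ B| + c) since d(A,B) ≤ 1, every element counted in this
-- numerator is counted in |A ⊖ C| + |B ⊖ C| (those of C alone twice), and A ∪ C and B ∪ C have
-- at most |A ∪ B| + c elements.
-- The adjustment only raises values of d, to 1. An unadjusted pair thus inherits the triangle
-- inequality. A pair raised in step (2) has f_uw + f_vw ≥ d_uv > 7/10. A pair raised in step (3)
-- has a heavy endpoint, whose pair with w is also raised to 1 (if that endpoint is w, this pair
-- is (u,v) itself). In the last two cases 10/7 · (f_uw + f_vw) ≥ 1.
module Submission where

open import Defs
open import Data.Nat using (ℕ)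
open import Data.Integer using (+_)
open import Data.Rational using (_/_)

import Data.Nat as Nat
import Data.Nat.Properties as ℕP
open import Data.Nat.Tactic.RingSolver using (solve-∀)
open import Algebra.Properties.CommutativeSemigroup ℕP.+-commutativeSemigroup using (interchange)
import Data.Integer as ℤ
import Data.Integer.Properties as ℤP
open import Data.Bool using (Bool; true; false; not; _∧_; _∨_; _xor_; if_then_else_; T; T?)
open import Data.Bool.Properties using (T-∧; T-∨; T-not-≡; ∨-comm; xor-same)
open import Data.Fin using (Fin; _≟_)
open import Data.Fin.Subset using (Subset; Side; inside; outside; _∩_; _∪_; ∁; ∣_∣; _⊆_)
open import Data.Fin.Subset.Properties
  using (p⊆q⇒∣p∣≤∣q∣; p⊆p∪q; q⊆p∪q; x∈p∪q⁺; x∈p∪q⁻; ∩-comm; ∪-comm)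
import Data.Rational.Unnormalised as ℚᵘ
import Data.Rational.Unnormalised.Properties as ℚᵘₚ
open import Data.Empty using (⊥-elim)
open import Data.Product using (_,_; proj₁; proj₂)
open import Data.Sum as Sum using (_⊎_; inj₁; inj₂; [_,_]′)
open import Function using (_∘_)
open import Function.Bundles using (Equivalence)
open import Data.Vec using ([]; _∷_; zipWith)
open import Relation.Binary.PropositionalEquality
open import Relation.Nullary using (¬_; Dec; yes; no)
open import Relation.Nullary.Decidable using (⌊_⌋; toWitness; toWitnessFalse; fromWitnessFalse)

private variable n : ℕ

module Cardinality where
  open Nat using (_+_; _≤_; z≤n)
  open ℕP using (+-mono-≤; ≤-refl; m≤m+n; ≤-reflexive; ≤-trans)

  _⊖_ : Subset n → Subset n → Subset n
  p ⊖ q = zipWith _xor_ p q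

  χ : Side → ℕ
  χ inside  = 1
  χ outside = 0

  ∣x∷p∣≡χx+∣p∣ : ∀ x (p : Subset n) → ∣ x ∷ p ∣ ≡ χ x + ∣ p ∣
  ∣x∷p∣≡χx+∣p∣ inside  p = refl
  ∣x∷p∣≡χx+∣p∣ outside p = refl

  ∷-+-≡ : ∀ a b c (p q r : Subset n) →
          χ a + χ b ≡ χ c → ∣ p ∣ + ∣ q ∣ ≡ ∣ r ∣ → ∣ a ∷ p ∣ + ∣ b ∷ q ∣ ≡ ∣ c ∷ r ∣
  ∷-+-≡ a b c p q r ab≡c p+q≡r = begin
    ∣ a ∷ p ∣ + ∣ b ∷ q ∣          ≡⟨ cong₂ _+_ (∣x∷p∣≡χx+∣p∣ a p) (∣x∷p∣≡χx+∣p∣ b q) ⟩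
    (χ a + ∣ p ∣) + (χ b + ∣ q ∣)  ≡⟨ interchange (χ a) (∣ p ∣) (χ b) (∣ q ∣) ⟩
    (χ a + χ b) + (∣ p ∣ + ∣ q ∣)  ≡⟨ cong₂ _+_ ab≡c p+q≡r ⟩
    χ c + ∣ r ∣                    ≡⟨ ∣x∷p∣≡χx+∣p∣ c r ⟨
    ∣ c ∷ r ∣                      ∎
    where open ≡-Reasoning

  ∷-+-≤ : ∀ a b c d (p q r s : Subset n) →
          χ a + χ b ≤ χ c + χ d → ∣ p ∣ + ∣ q ∣ ≤ ∣ r ∣ + ∣ s ∣ →
          ∣ a ∷ p ∣ + ∣ b ∷ q ∣ ≤ ∣ c ∷ r ∣ + ∣ d ∷ s ∣
  ∷-+-≤ a b c d p q r s ab≤cd pq≤rs = begin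
    ∣ a ∷ p ∣ + ∣ b ∷ q ∣          ≡⟨ cong₂ _+_ (∣x∷p∣≡χx+∣p∣ a p) (∣x∷p∣≡χx+∣p∣ b q) ⟩
    (χ a + ∣ p ∣) + (χ b + ∣ q ∣)  ≡⟨ interchange (χ a) (∣ p ∣) (χ b) (∣ q ∣) ⟩
    (χ a + χ b) + (∣ p ∣ + ∣ q ∣)  ≤⟨ +-mono-≤ ab≤cd pq≤rs ⟩
    (χ c + χ d) + (∣ r ∣ + ∣ s ∣)  ≡⟨ interchange (χ c) (∣ r ∣) (χ d) (∣ s ∣) ⟨
    (χ c + ∣ r ∣) + (χ d + ∣ s ∣)  ≡⟨ cong₂ _+_ (∣x∷p∣≡χx+∣p∣ c r) (∣x∷p∣≡χx+∣p∣ d s) ⟨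
    ∣ c ∷ r ∣ + ∣ d ∷ s ∣          ∎
    where open ℕP.≤-Reasoning

  ∣p∩q∣+∣p⊖q∣≡∣p∪q∣ : ∀ (p q : Subset n) → ∣ p ∩ q ∣ + ∣ p ⊖ q ∣ ≡ ∣ p ∪ q ∣
  ∣p∩q∣+∣p⊖q∣≡∣p∪q∣ []      []      = refl
  ∣p∩q∣+∣p⊖q∣≡∣p∪q∣ (x ∷ p) (y ∷ q) =
    ∷-+-≡ (x ∧ y) (x xor y) (x ∨ y) (p ∩ q) (p ⊖ q) (p ∪ q)
          (pointwise x y) (∣p∩q∣+∣p⊖q∣≡∣p∪q∣ p q)
    where
    pointwise : ∀ x y → χ (x ∧ y) + χ (x xor y) ≡ χ (x ∨ y)
    pointwise true  true  = refl
    pointwise true  false = refl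
    pointwise false y     = refl

  ∣p⊖q∣≤∣p∪q∣ : ∀ (p q : Subset n) → ∣ p ⊖ q ∣ ≤ ∣ p ∪ q ∣
  ∣p⊖q∣≤∣p∪q∣ p q = ≤-trans (ℕP.m≤n+m (∣ p ⊖ q ∣) (∣ p ∩ q ∣)) (≤-reflexive (∣p∩q∣+∣p⊖q∣≡∣p∪q∣ p q))

  ∣p∣+∣∁p∩q∣≡∣p∪q∣ : ∀ (p q : Subset n) → ∣ p ∣ + ∣ ∁ p ∩ q ∣ ≡ ∣ p ∪ q ∣
  ∣p∣+∣∁p∩q∣≡∣p∪q∣ []      []      = refl
  ∣p∣+∣∁p∩q∣≡∣p∪q∣ (x ∷ p) (y ∷ q) =
    ∷-+-≡ x (not x ∧ y) (x ∨ y) p (∁ p ∩ q) (p ∪ q) (pointwise x y) (∣p∣+∣∁p∩q∣≡∣p∪q∣ p q)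
    where
    pointwise : ∀ x y → χ x + χ (not x ∧ y) ≡ χ (x ∨ y)
    pointwise true  y = refl
    pointwise false y = refl

  ∣p⊖q∣+∣∁[p∪q]∩r∣≤∣p⊖r∣+∣q⊖r∣ : ∀ (p q r : Subset n) →
                                 ∣ p ⊖ q ∣ + ∣ ∁ (p ∪ q) ∩ r ∣ ≤ ∣ p ⊖ r ∣ + ∣ q ⊖ r ∣
  ∣p⊖q∣+∣∁[p∪q]∩r∣≤∣p⊖r∣+∣q⊖r∣ []      []      []      = z≤n
  ∣p⊖q∣+∣∁[p∪q]∩r∣≤∣p⊖r∣+∣q⊖r∣ (x ∷ p) (y ∷ q) (z ∷ r) =
    ∷-+-≤ (x xor y) (not (x ∨ y) ∧ z) (x xor z) (y xor z) (p ⊖ q) (∁ (p ∪ q) ∩ r) (p ⊖ r) (q ⊖ r)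
          (pointwise x y z) (∣p⊖q∣+∣∁[p∪q]∩r∣≤∣p⊖r∣+∣q⊖r∣ p q r)
    where
    pointwise : ∀ x y z → χ (x xor y) + χ (not (x ∨ y) ∧ z) ≤ χ (x xor z) + χ (y xor z)
    pointwise true  true  z     = z≤n
    pointwise true  false true  = ≤-refl
    pointwise true  false false = ≤-refl
    pointwise false true  true  = ≤-refl
    pointwise false true  false = ≤-refl
    pointwise false false z     = m≤m+n (χ z) (χ z)

  ∣p⊖p∣≡0 : ∀ (p : Subset n) → ∣ p ⊖ p ∣ ≡ 0
  ∣p⊖p∣≡0 []      = refl
  ∣p⊖p∣≡0 (x ∷ p) =
    trans (∣x∷p∣≡χx+∣p∣ (x xor x) (p ⊖ p)) (cong₂ _+_ (cong χ (xor-same x)) (∣p⊖p∣≡0 p))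

  ∪-monoˡ-⊆ : ∀ {p q : Subset n} (r : Subset n) → p ⊆ q → p ∪ r ⊆ q ∪ r
  ∪-monoˡ-⊆ {p = p} r p⊆q x∈p∪r = x∈p∪q⁺ (Sum.map₁ p⊆q (x∈p∪q⁻ p r x∈p∪r))

module CrossMultiplication where
  open Nat using (_+_; _*_; _≤_)
  open ℕP using (*-distribˡ-+; *-distribʳ-+; *-comm; *-monoˡ-≤; *-monoʳ-≤; +-mono-≤; +-monoʳ-≤)

  m≤n⇒m*[n+o]≤[m+o]*n : ∀ {m n} o → m ≤ n → m * (n + o) ≤ (m + o) * n
  m≤n⇒m*[n+o]≤[m+o]*n {m} {n} o m≤n = begin
    m * (n + o)        ≡⟨ *-distribˡ-+ m n o ⟩
    m * n + m * o      ≤⟨ +-monoʳ-≤ (m * n) (*-monoˡ-≤ o m≤n) ⟩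
    m * n + n * o      ≡⟨ cong (_+_ (m * n)) (*-comm n o) ⟩
    m * n + o * n      ≡⟨ *-distribʳ-+ n m o ⟨
    (m + o) * n        ∎
    where open ℕP.≤-Reasoning

  sum-cross-≤ : ∀ a b {A B C} → A ≤ C → B ≤ C → (a + b) * (A * B) ≤ (a * B + b * A) * C
  sum-cross-≤ a b {A} {B} {C} A≤C B≤C = begin
    (a + b) * (A * B)          ≡⟨ rearrange a b A B ⟩
    a * B * A + b * A * B      ≤⟨ +-mono-≤ (*-monoʳ-≤ (a * B) A≤C) (*-monoʳ-≤ (b * A) B≤C) ⟩
    a * B * C + b * A * C      ≡⟨ *-distribʳ-+ C (a * B) (b * A) ⟨
    (a * B + b * A) * C        ∎
    where
    open ℕP.≤-Reasoning
    rearrange : ∀ a b A B → (a + b) * (A * B) ≡ a * B * A + b * A * B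
    rearrange = solve-∀

open Cardinality
open CrossMultiplication
open import Data.Rational using (ℚ; 0ℚ; 1ℚ; _+_; _-_; -_; _*_; _≤_; _<?_; toℚᵘ; nonNegative)
open import Data.Rational.Properties
  using (toℚᵘ-fromℚᵘ; toℚᵘ-cancel-≤; toℚᵘ-injective; toℚᵘ-homo-+; /-cong; 0/n≡0;
         +-assoc; +-inverseʳ; +-identityʳ; *-identityˡ; ≤-refl; ≤-reflexive; ≤-trans; <⇒≤; ≤ᵇ⇒≤;
         +-mono-≤; *-monoʳ-≤-nonNeg; *-monoˡ-≤-nonNeg; module ≤-Reasoning)

toℚᵘ-/ : ∀ i U .{{_ : Nat.NonZero U}} → toℚᵘ (i / U) ℚᵘ.≃ i ℚᵘ./ U
toℚᵘ-/ i (Nat.suc k) = toℚᵘ-fromℚᵘ (ℚᵘ.mkℚᵘ i k)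

/-mono-cross-≤ : ∀ m U m′ U′ .{{_ : Nat.NonZero U}} .{{_ : Nat.NonZero U′}} →
                 m Nat.* U′ Nat.≤ m′ Nat.* U → + m / U ≤ + m′ / U′
/-mono-cross-≤ m U@(Nat.suc _) m′ U′@(Nat.suc _) m*U′≤m′*U = toℚᵘ-cancel-≤
  (ℚᵘₚ.≤-respˡ-≃ (ℚᵘₚ.≃-sym (toℚᵘ-/ (+ m) U))
    (ℚᵘₚ.≤-respʳ-≃ (ℚᵘₚ.≃-sym (toℚᵘ-/ (+ m′) U′))
      (ℚᵘ.*≤* (subst₂ ℤ._≤_ (ℤP.pos-* m U′) (ℤP.pos-* m′ U) (ℤ.+≤+ m*U′≤m′*U)))))

/-+ : ∀ a b A B .{{_ : Nat.NonZero A}} .{{_ : Nat.NonZero B}} →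
      (+ a / A) + (+ b / B) ≡ (+ (a Nat.* B Nat.+ b Nat.* A) / (A Nat.* B)) {{ℕP.m*n≢0 A B}}
/-+ a b A@(Nat.suc _) B@(Nat.suc _) = toℚᵘ-injective (begin
  toℚᵘ ((+ a / A) + (+ b / B))              ≈⟨ toℚᵘ-homo-+ (+ a / A) (+ b / B) ⟩
  toℚᵘ (+ a / A) ℚᵘ.+ toℚᵘ (+ b / B)        ≈⟨ ℚᵘₚ.+-cong (toℚᵘ-/ (+ a) A) (toℚᵘ-/ (+ b) B) ⟩
  (+ a ℚᵘ./ A) ℚᵘ.+ (+ b ℚᵘ./ B)            ≡⟨ ℚᵘₚ./-cong numerator refl ⟩
  + (a Nat.* B Nat.+ b Nat.* A) ℚᵘ./ (A Nat.* B)  ≈⟨ toℚᵘ-/ _ (A Nat.* B) ⟨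
  toℚᵘ (+ (a Nat.* B Nat.+ b Nat.* A) / (A Nat.* B)) ∎)
  where
  open ℚᵘₚ.≃-Reasoning
  numerator : + a ℤ.* + B ℤ.+ + b ℤ.* + A ≡ + (a Nat.* B Nat.+ b Nat.* A)
  numerator = sym (trans (ℤP.pos-+ (a Nat.* B) (b Nat.* A)) (cong₂ ℤ._+_ (ℤP.pos-* a B) (ℤP.pos-* b A)))

n/n≡1 : ∀ N .{{_ : Nat.NonZero N}} → + N / N ≡ 1ℚ
n/n≡1 N@(Nat.suc _) =
  toℚᵘ-injective (ℚᵘₚ.≃-trans (toℚᵘ-/ (+ N) N) (ℚᵘ.*≡* (ℤP.*-comm (+ N) (+ 1))))

1-/ : ∀ i m {U} .{{_ : Nat.NonZero U}} → i Nat.+ m ≡ U → 1ℚ - (+ i / U) ≡ + m / U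
1-/ i m {U} i+m≡U = begin
  1ℚ - x         ≡⟨ cong (_- x) y+x≡1 ⟨
  (y + x) - x    ≡⟨ +-assoc y x (- x) ⟩
  y + (x - x)    ≡⟨ cong (_+_ y) (+-inverseʳ x) ⟩
  y + 0ℚ         ≡⟨ +-identityʳ y ⟩
  y              ∎
  where
  open ≡-Reasoning
  instance
    U*U≢0 : Nat.NonZero (U Nat.* U)
    U*U≢0 = ℕP.m*n≢0 U U
  x y : ℚ
  x = + i / U
  y = + m / U
  m*U+i*U≡U*U : m Nat.* U Nat.+ i Nat.* U ≡ U Nat.* U
  m*U+i*U≡U*U = trans (sym (ℕP.*-distribʳ-+ U m i)) (cong (Nat._* U) (trans (ℕP.+-comm m i) i+m≡U))
  y+x≡1 : y + x ≡ 1ℚ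
  y+x≡1 = trans (/-+ m i U U) (trans (/-cong (cong +_ m*U+i*U≡U*U) refl) (n/n≡1 (U Nat.* U)))

/-triangle : ∀ {m₁ U₁ m₂ U₂ m₃ U₃} c
             .{{_ : Nat.NonZero U₁}} .{{_ : Nat.NonZero U₂}} .{{_ : Nat.NonZero U₃}} →
             m₁ Nat.≤ U₁ → m₁ Nat.+ c Nat.≤ m₂ Nat.+ m₃ → U₂ Nat.≤ U₁ Nat.+ c → U₃ Nat.≤ U₁ Nat.+ c →
             + m₁ / U₁ ≤ (+ m₂ / U₂) + (+ m₃ / U₃)
/-triangle {m₁} {U₁} {m₂} {U₂} {m₃} {U₃} c m₁≤U₁ m₁+c≤m₂+m₃ U₂≤U₁+c U₃≤U₁+c = begin
  + m₁ / U₁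
    ≤⟨ /-mono-cross-≤ m₁ U₁ (m₁ Nat.+ c) U (m≤n⇒m*[n+o]≤[m+o]*n c m₁≤U₁) ⟩
  + (m₁ Nat.+ c) / U
    ≤⟨ /-mono-cross-≤ (m₁ Nat.+ c) U (m₂ Nat.+ m₃) U (ℕP.*-monoˡ-≤ U m₁+c≤m₂+m₃) ⟩
  + (m₂ Nat.+ m₃) / U
    ≤⟨ /-mono-cross-≤ (m₂ Nat.+ m₃) U m (U₂ Nat.* U₃) (sum-cross-≤ m₂ m₃ U₂≤U₁+c U₃≤U₁+c) ⟩
  + m / (U₂ Nat.* U₃)
    ≡⟨ /-+ m₂ m₃ U₂ U₃ ⟨
  (+ m₂ / U₂) + (+ m₃ / U₃)
    ∎
  where
  open ≤-Reasoning
  U = U₁ Nat.+ c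
  m = m₂ Nat.* U₃ Nat.+ m₃ Nat.* U₂
  instance
    U≢0 : Nat.NonZero U
    U≢0 = Nat.>-nonZero (ℕP.≤-trans (Nat.>-nonZero⁻¹ U₁) (ℕP.m≤m+n U₁ c))
    U₂*U₃≢0 : Nat.NonZero (U₂ Nat.* U₃)
    U₂*U₃≢0 = ℕP.m*n≢0 U₂ U₃

jaccard : (p q : Subset n) .{{_ : Nat.NonZero ∣ p ∪ q ∣}} → ℚ
jaccard p q = + ∣ p ⊖ q ∣ / ∣ p ∪ q ∣

module _ (p q : Subset n) .{{_ : Nat.NonZero ∣ p ∪ q ∣}} where

  jaccard-nonNeg : 0ℚ ≤ jaccard p q
  jaccard-nonNeg = /-mono-cross-≤ 0 1 ∣ p ⊖ q ∣ ∣ p ∪ q ∣ Nat.z≤n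

  jaccard≤1 : jaccard p q ≤ 1ℚ
  jaccard≤1 = /-mono-cross-≤ ∣ p ⊖ q ∣ ∣ p ∪ q ∣ 1 1
    (subst₂ Nat._≤_ (sym (ℕP.*-identityʳ _)) (sym (ℕP.*-identityˡ _)) (∣p⊖q∣≤∣p∪q∣ p q))

jaccard-self : ∀ (p : Subset n) .{{_ : Nat.NonZero ∣ p ∪ p ∣}} → jaccard p p ≡ 0ℚ
jaccard-self p = trans (/-cong (cong +_ (∣p⊖p∣≡0 p)) refl) (0/n≡0 ∣ p ∪ p ∣)

jaccard-triangle : ∀ (p q r : Subset n)
                   .{{_ : Nat.NonZero ∣ p ∪ q ∣}} .{{_ : Nat.NonZero ∣ p ∪ r ∣}} .{{_ : Nat.NonZero ∣ q ∪ r ∣}} →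
                   jaccard p q ≤ jaccard p r + jaccard q r
jaccard-triangle p q r = /-triangle {m₂ = ∣ p ⊖ r ∣} {m₃ = ∣ q ⊖ r ∣} ∣ ∁ (p ∪ q) ∩ r ∣
  (∣p⊖q∣≤∣p∪q∣ p q) (∣p⊖q∣+∣∁[p∪q]∩r∣≤∣p⊖r∣+∣q⊖r∣ p q r)
  (∪r-bound (p⊆p∪q {p = p} q)) (∪r-bound (q⊆p∪q p q))
  where
  ∪r-bound : ∀ {s} → s ⊆ p ∪ q → ∣ s ∪ r ∣ Nat.≤ ∣ p ∪ q ∣ Nat.+ ∣ ∁ (p ∪ q) ∩ r ∣
  ∪r-bound s⊆p∪q = ℕP.≤-trans (p⊆q⇒∣p∣≤∣q∣ (∪-monoˡ-⊆ r s⊆p∪q))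
                              (ℕP.≤-reflexive (sym (∣p∣+∣∁p∩q∣≡∣p∪q∣ (p ∪ q) r)))

1≤10/7 : 1ℚ ≤ + 10 / 7
1≤10/7 = ≤ᵇ⇒≤ _

p≤10/7*p : ∀ {p} → 0ℚ ≤ p → p ≤ (+ 10 / 7) * p
p≤10/7*p {p} 0≤p =
  subst (_≤ (+ 10 / 7) * p) (*-identityˡ p) (*-monoʳ-≤-nonNeg p {{nonNegative 0≤p}} 1≤10/7)

7/10≤p⇒1≤10/7*p : ∀ {p} → + 7 / 10 ≤ p → 1ℚ ≤ (+ 10 / 7) * p
7/10≤p⇒1≤10/7*p = *-monoˡ-≤-nonNeg (+ 10 / 7)

if-elim : ∀ {A : Set} (P : A → Set) b {x y : A} → P x → P y → P (if b then x else y)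
if-elim P true  px py = px
if-elim P false px py = py

if-T : ∀ {A : Set} b {x y : A} → T b → (if b then x else y) ≡ x
if-T true _ = refl

if-¬T : ∀ {A : Set} b {x y : A} → ¬ T b → (if b then x else y) ≡ y
if-¬T true  ¬t = ⊥-elim (¬t _)
if-¬T false _  = refl

⌊≟⌋-sym : ∀ (i j : Fin n) → ⌊ i ≟ j ⌋ ≡ ⌊ j ≟ i ⌋
⌊≟⌋-sym i j with i ≟ j | j ≟ i
... | yes _   | yes _   = refl
... | no _    | no _    = refl
... | yes i≡j | no j≢i  = ⊥-elim (j≢i (sym i≡j))
... | no i≢j  | yes j≡i = ⊥-elim (i≢j (sym j≡i))

module _ (G : SignedGraph n) where
  open SignedGraph G

  instance
    N⁺∪N⁺-nonZero : ∀ {u v} → Nat.NonZero ∣ N⁺ G u ∪ N⁺ G v ∣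
    N⁺∪N⁺-nonZero {u} {v} = unionNonZero G u v

  d≡jaccard : ∀ u v → d G u v ≡ jaccard (N⁺ G u) (N⁺ G v)
  d≡jaccard u v = 1-/ ∣ A ∩ B ∣ ∣ A ⊖ B ∣ (∣p∩q∣+∣p⊖q∣≡∣p∪q∣ A B)
    where A = N⁺ G u; B = N⁺ G v

  d-nonNeg : ∀ u v → 0ℚ ≤ d G u v
  d-nonNeg u v = subst (0ℚ ≤_) (sym (d≡jaccard u v)) (jaccard-nonNeg (N⁺ G u) (N⁺ G v))

  d≤1 : ∀ u v → d G u v ≤ 1ℚ
  d≤1 u v = subst (_≤ 1ℚ) (sym (d≡jaccard u v)) (jaccard≤1 (N⁺ G u) (N⁺ G v))

  d-self : ∀ u → d G u u ≡ 0ℚ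
  d-self u = trans (d≡jaccard u u) (jaccard-self (N⁺ G u))

  d-sym : ∀ u v → d G u v ≡ d G v u
  d-sym u v = cong (_-_ 1ℚ) (/-cong (cong (λ s → + ∣ s ∣) (∩-comm A B)) (cong ∣_∣ (∪-comm A B)))
    where A = N⁺ G u; B = N⁺ G v

  d-triangle : ∀ u v w → d G u v ≤ d G u w + d G v w
  d-triangle u v w = subst₂ _≤_ (sym (d≡jaccard u v)) (sym (cong₂ _+_ (d≡jaccard u w) (d≡jaccard v w)))
    (jaccard-triangle (N⁺ G u) (N⁺ G v) (N⁺ G w))

  adjusted : Fin n → Fin n → Bool
  adjusted u v = step2 G u v ∨ step3 G u v

  d≤f : ∀ u v → d G u v ≤ f G u v
  d≤f u v = if-elim (d G u v ≤_) (adjusted u v) (d≤1 u v) ≤-refl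

  f-nonNeg : ∀ u v → 0ℚ ≤ f G u v
  f-nonNeg u v = ≤-trans (d-nonNeg u v) (d≤f u v)

  f-self : ∀ u → f G u u ≡ 0ℚ
  f-self u =
    trans (if-¬T (adjusted u u) ([ negative-loop , distinct-loop ]′ ∘ Equivalence.to T-∨)) (d-self u)
    where
    negative-loop : ¬ T (step2 G u u)
    negative-loop t
      with trans (sym (pos-refl u)) (Equivalence.to T-not-≡ (proj₁ (Equivalence.to (T-∧ {x = not (pos u u)}) t)))
    ... | ()
    distinct-loop : ¬ T (step3 G u u)
    distinct-loop t = toWitnessFalse (proj₁ (Equivalence.to (T-∧ {x = not ⌊ u ≟ u ⌋}) t)) refl

  f-sym : ∀ u v → f G u v ≡ f G v u
  f-sym u v = cong₂ (λ b x → if b then 1ℚ else x) (cong₂ _∨_ step2-sym step3-sym) (d-sym u v)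
    where
    step2-sym : step2 G u v ≡ step2 G v u
    step2-sym = cong₂ (λ b x → not b ∧ ⌊ sevenTenths G <? x ⌋) (pos-sym u v) (d-sym u v)
    step3-sym : step3 G u v ≡ step3 G v u
    step3-sym = cong₂ (λ b c → not b ∧ c) (⌊≟⌋-sym u v) (∨-comm (heavy G u) (heavy G v))

  step3⇒f≡1 : ∀ {u v} → T (step3 G u v) → f G u v ≡ 1ℚ
  step3⇒f≡1 {u} {v} t = if-T (adjusted u v) (Equivalence.from T-∨ (inj₂ t))

  heavy⇒f≡1 : ∀ {u} v → T (heavy G u) → u ≢ v → f G u v ≡ 1ℚ
  heavy⇒f≡1 {u} v heavy-u u≢v =
    step3⇒f≡1 (Equivalence.from T-∧ (fromWitnessFalse u≢v , Equivalence.from T-∨ (inj₁ heavy-u)))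

  step3⇒f[u,w]≡1⊎f[v,w]≡1 : ∀ {u v} w → T (step3 G u v) → f G u w ≡ 1ℚ ⊎ f G v w ≡ 1ℚ
  step3⇒f[u,w]≡1⊎f[v,w]≡1 {u} {v} w t = by-cases (u ≟ w) (v ≟ w)
    where
    f[u,v]≡1 : f G u v ≡ 1ℚ
    f[u,v]≡1 = step3⇒f≡1 t
    by-cases : Dec (u ≡ w) → Dec (v ≡ w) → f G u w ≡ 1ℚ ⊎ f G v w ≡ 1ℚ
    by-cases (yes u≡w) _         = inj₂ (trans (cong (f G v) (sym u≡w)) (trans (f-sym v u) f[u,v]≡1))
    by-cases (no _)    (yes v≡w) = inj₁ (trans (cong (f G u) (sym v≡w)) f[u,v]≡1)
    by-cases (no u≢w)  (no v≢w)  =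
      Sum.map (λ heavy-u → heavy⇒f≡1 w heavy-u u≢w) (λ heavy-v → heavy⇒f≡1 w heavy-v v≢w)
              (Equivalence.to T-∨ (proj₂ (Equivalence.to (T-∧ {x = not ⌊ u ≟ v ⌋}) t)))

  d≤f+f : ∀ u v w → d G u v ≤ f G u w + f G v w
  d≤f+f u v w = ≤-trans (d-triangle u v w) (+-mono-≤ (d≤f u w) (d≤f v w))

  adjusted⇒7/10≤f+f : ∀ {u v} w → T (adjusted u v) → + 7 / 10 ≤ f G u w + f G v w
  adjusted⇒7/10≤f+f {u} {v} w t = [ from-step2 , from-step3 ]′ (Equivalence.to T-∨ t)
    where
    from-step2 : T (step2 G u v) → + 7 / 10 ≤ f G u w + f G v w
    from-step2 t₂ =
      ≤-trans (<⇒≤ (toWitness (proj₂ (Equivalence.to (T-∧ {x = not (pos u v)}) t₂)))) (d≤f+f u v w)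
    from-step3 : T (step3 G u v) → + 7 / 10 ≤ f G u w + f G v w
    from-step3 t₃ = ≤-trans (≤ᵇ⇒≤ _) ([ one-left , one-right ]′ (step3⇒f[u,w]≡1⊎f[v,w]≡1 w t₃))
      where
      one-left : f G u w ≡ 1ℚ → 1ℚ ≤ f G u w + f G v w
      one-left f[u,w]≡1 = +-mono-≤ (≤-reflexive (sym f[u,w]≡1)) (f-nonNeg v w)
      one-right : f G v w ≡ 1ℚ → 1ℚ ≤ f G u w + f G v w
      one-right f[v,w]≡1 = +-mono-≤ (f-nonNeg u w) (≤-reflexive (sym f[v,w]≡1))

  f-relaxed-triangle : ∀ u v w → f G u v ≤ (+ 10 / 7) * (f G u w + f G v w)
  f-relaxed-triangle u v w = by-cases (T? (adjusted u v))
    where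
    open ≤-Reasoning
    by-cases : Dec (T (adjusted u v)) → f G u v ≤ (+ 10 / 7) * (f G u w + f G v w)
    by-cases (yes adj) = begin
      f G u v                           ≡⟨ if-T (adjusted u v) adj ⟩
      1ℚ                                ≤⟨ 7/10≤p⇒1≤10/7*p (adjusted⇒7/10≤f+f w adj) ⟩
      (+ 10 / 7) * (f G u w + f G v w)  ∎
    by-cases (no ¬adj) = begin
      f G u v                           ≡⟨ if-¬T (adjusted u v) ¬adj ⟩
      d G u v                           ≤⟨ d≤f+f u v w ⟩
      f G u w + f G v w                 ≤⟨ p≤10/7*p (+-mono-≤ (f-nonNeg u w) (f-nonNeg v w)) ⟩
      (+ 10 / 7) * (f G u w + f G v w)  ∎

lemma1 : ∀ {n : ℕ} (G : SignedGraph n) → IsSemiMetricδ (+ 10 / 7) (f G)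
lemma1 G = record
  { nonneg  = f-nonNeg G
  ; symm    = f-sym G
  ; self    = f-self G
  ; relaxed = f-relaxed-triangle G
  }
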